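{- Let $(G,*)$ be a groupoid satisfying the identities (i) $x(yz)\approx x(zy)$, (ii) $w(x(yz))\approx w((xy)z)$, (iii) $(xy)z\approx(xz)y$, (iv) $(wx)(yz)\approx(wy)(xz)$, (v) $(((vw)x)y)z\approx v(w(x(yz)))$. Then $s_n(*)\le 1$ for $n=1,2$, $s_n(*)\le2$ for $n=3$, $s_n(*)\le3$ for $n\ge4$, and $s^{ac}_n(*)\le n$ for $n=1,2$, $s^{ac}_n(*)\le 2n$ for $n=3$, $s^{ac}_n(*)\le 3n$ for $n\ge4$. The first inequality holds as an equality if the second does, and both equalities hold for the 3-element groupoids $\mathrm{SC}3242$ (rows $0{:}\ 1\,1\,1$; $1{:}\ 2\,2\,2$; $2{:}\ 0\,0\,0$) and $\mathrm{SC}3302$ (rows $0{:}\ 1\,2\,0$; $1{:}\ 1\,2\,0$; $2{:}\ 1\,2\,0$).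
   Context: A groupoid $(G,*)$ is a set with a binary operation; $xy$ denotes $x*y$. $\mathcal B_n$ is the set of bracketings of the word $x_1x_2\cdots x_n$ (all ways to insert parentheses), and $\mathcal F_n$ is the set of full linear terms, obtained from bracketings by permuting the variables. Each such term $t$ induces an $n$-ary operation $t^*$ on $G$. The associative spectrum is $s_n(*):=|\{t^*:t\in\mathcal B_n\}|$ and the associative-commutative spectrum is $s^{ac}_n(*):=|\{t^*:t\in\mathcal F_n\}|$. A groupoid satisfies an identity if both sides take equal values under every assignment of elements of $G$ to the variables. A 3-element groupoid on $\{0,1,2\}$ is given by its Cayley table; "row $a{:}\ p\,q\,r$" means $a*0=p$, $a*1=q$, $a*2=r$. -}

module Defs where

open import Data.Nat using (ℕ; zero; suc; _+_; _*_)
open import Data.Fin using (Fin; zero; suc; _↑ˡ_; _↑ʳ_)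
open import Data.Fin.Permutation using (Permutation′; _⟨$⟩ʳ_)
open import Data.Product using (Σ; ∃; _×_; _,_)
open import Relation.Binary.PropositionalEquality using (_≡_; _≢_)
open import Relation.Nullary using (¬_)

-- Bracketings of the word x₁x₂⋯xₙ: binary trees with n leaves,
-- the leaves being labelled x₁,…,xₙ from left to right.
data Bracketing : ℕ → Set where
  leaf : Bracketing 1
  node : ∀ {m k} → Bracketing m → Bracketing k → Bracketing (m + k)

⟦_⟧ : ∀ {G : Set} {n} → Bracketing n → (G → G → G) → (Fin n → G) → G
⟦ leaf ⟧ op x = x zero
⟦ node {m} {k} l r ⟧ op x =
  op (⟦ l ⟧ op (λ i → x (i ↑ˡ k))) (⟦ r ⟧ op (λ i → x (m ↑ʳ i)))

-- Full linear terms: a bracketing whose variables x₁,…,xₙ are permuted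
-- by a permutation σ, i.e. the leaves read x_{σ(1)},…,x_{σ(n)}.
FullLinear : ℕ → Set
FullLinear n = Bracketing n × Permutation′ n

⟦_⟧ᶠ : ∀ {G : Set} {n} → FullLinear n → (G → G → G) → (Fin n → G) → G
⟦ (b , σ) ⟧ᶠ op x = ⟦ b ⟧ op (λ i → x (σ ⟨$⟩ʳ i))

_≐_ : ∀ {G : Set} {n} → ((Fin n → G) → G) → ((Fin n → G) → G) → Set
f ≐ g = ∀ x → f x ≡ g x

-- |{ ⟦ t ⟧ : t ∈ T }| ≤ k : the image is covered by k term operations.
ImageCard≤ : ∀ {G : Set} {n} (T : Set) → (T → (Fin n → G) → G) → ℕ → Set
ImageCard≤ T ⟦⟧ k =
  Σ (Fin k → T) λ rep → ∀ t → ∃ λ i → ⟦⟧ t ≐ ⟦⟧ (rep i)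

-- |{ ⟦ t ⟧ : t ∈ T }| = k : k pairwise distinct term operations that
-- cover the image.
ImageCard≡ : ∀ {G : Set} {n} (T : Set) → (T → (Fin n → G) → G) → ℕ → Set
ImageCard≡ T ⟦⟧ k =
  Σ (Fin k → T) λ rep →
    (∀ t → ∃ λ i → ⟦⟧ t ≐ ⟦⟧ (rep i)) ×
    (∀ i j → i ≢ j → ¬ (⟦⟧ (rep i) ≐ ⟦⟧ (rep j)))

sₙ≤ sₙ≡ : (G : Set) → (G → G → G) → ℕ → ℕ → Set
sₙ≤ G op n k = ImageCard≤ {G} {n} (Bracketing n) (λ t → ⟦ t ⟧ op) k
sₙ≡ G op n k = ImageCard≡ {G} {n} (Bracketing n) (λ t → ⟦ t ⟧ op) k

sacₙ≤ sacₙ≡ : (G : Set) → (G → G → G) → ℕ → ℕ → Set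
sacₙ≤ G op n k = ImageCard≤ {G} {n} (FullLinear n) (λ t → ⟦ t ⟧ᶠ op) k
sacₙ≡ G op n k = ImageCard≡ {G} {n} (FullLinear n) (λ t → ⟦ t ⟧ᶠ op) k

Identities : (G : Set) → (G → G → G) → Set
Identities G _∙_ =
  (∀ x y z → x ∙ (y ∙ z) ≡ x ∙ (z ∙ y)) ×
  (∀ w x y z → w ∙ (x ∙ (y ∙ z)) ≡ w ∙ ((x ∙ y) ∙ z)) ×
  (∀ x y z → (x ∙ y) ∙ z ≡ (x ∙ z) ∙ y) ×
  (∀ w x y z → (w ∙ x) ∙ (y ∙ z) ≡ (w ∙ y) ∙ (x ∙ z)) ×
  (∀ v w x y z → (((v ∙ w) ∙ x) ∙ y) ∙ z ≡ v ∙ (w ∙ (x ∙ (y ∙ z))))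

-- The bound for s_n: 1 for n = 1,2; 2 for n = 3; 3 for n ≥ 4.
-- (Only used for n ≥ 1.)
bound : ℕ → ℕ
bound 0 = 1
bound 1 = 1
bound 2 = 1
bound 3 = 2
bound (suc (suc (suc (suc _)))) = 3

SC3242 : Fin 3 → Fin 3 → Fin 3
SC3242 zero _ = suc zero
SC3242 (suc zero) _ = suc (suc zero)
SC3242 (suc (suc zero)) _ = zero

SC3302 : Fin 3 → Fin 3 → Fin 3
SC3302 _ zero = suc zero
SC3302 _ (suc zero) = suc (suc zero)
SC3302 _ (suc (suc zero)) = zero

-- Read a bracketing as a binary tree and let d be its left depth, the length of
-- its leftmost branch. Identities (i)–(iv) rewrite every product into a normal form
-- fixed by the first variable, d, and the multiset of the remaining variables, and (v)
-- shows that d ≥ 1 only matters modulo 3. A word of n letters admits 1, 1, 2, 3 such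
-- classes for n = 1, 2, 3, ≥ 4, bounding s_n; in a full linear term the first
-- variable can be any of the n, bounding s^ac_n. If s^ac_n attains its bound, two
-- coinciding bracketing representatives would make the n·bound full linear ones
-- coincide too, so s_n attains its bound as well. In SC3242, xy = x + 1 (mod 3), so a
-- term evaluates to x₁ + d; SC3302 is its opposite, where the right depth and the last
-- variable play these roles.

module Submission where

open import Defs
open import Data.Nat using (ℕ; zero; suc; _+_; _*_; _≤_; _<_; z≤n; s≤s)
open import Data.Nat.Properties using (≤-trans; +-comm; +-suc; suc-injective; n<1+n; m<m+n; m≤n+m)
open import Data.Fin using (Fin; zero; suc; toℕ; fromℕ; _↑ˡ_; _↑ʳ_; punchIn; punchOut; combine; remQuot)
open import Data.Fin.Properties
  using (toℕ-injective; toℕ-↑ˡ; toℕ-↑ʳ; toℕ-fromℕ; remQuot-combine; combine-injective; combine-surjective;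
         punchOut-injective; <⇒notInjective)
  renaming (_≟_ to _≟ᶠ_)
open import Data.Fin.Permutation using (Permutation′; _⟨$⟩ʳ_; transpose; remove; punchIn-permute)
open import Data.List using (List; []; _∷_; _++_; length; tabulate)
open import Data.List.Properties using (++-assoc; length-++; length-tabulate; tabulate-cong; ∷-injective)
open import Data.List.Relation.Binary.Permutation.Propositional as ↭
  using (_↭_; prep; swap; ↭-refl; ↭-trans; ↭-sym; ↭-reflexive)
open import Data.List.Relation.Binary.Permutation.Propositional.Properties using (++-comm; drop-∷)
open import Data.Product using (_×_; _,_; proj₁; proj₂; ∃)
open import Data.Unit using (⊤; tt)
open import Data.Empty using (⊥-elim)
open import Function using (_∘_)
open import Function.Definitions using (Injective)
open import Relation.Nullary using (yes; no; contradiction)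
open import Relation.Nullary.Decidable using (dec-true)
open import Relation.Binary.PropositionalEquality
  using (_≡_; _≢_; refl; sym; trans; cong; cong₂; subst; subst₂; module ≡-Reasoning)

-- Depth classes

-- δ₀ is the depth 0 of a single letter; a depth d ≥ 1 is classified by d mod 3.
data DepthClass : Set where
  δ₀ δ₁ δ₂ δ₃ : DepthClass

next : DepthClass → DepthClass
next δ₀ = δ₁
next δ₁ = δ₂
next δ₂ = δ₃
next δ₃ = δ₁

classOf : ℕ → DepthClass
classOf zero = δ₀
classOf (suc d) = next (classOf d)

-- Fits δ m: a bracketing of 1 + m letters can have a depth of class δ.
Fits : DepthClass → ℕ → Set
Fits δ₀ m = m ≡ 0
Fits δ₁ m = 1 ≤ m
Fits δ₂ m = 2 ≤ m
Fits δ₃ m = 3 ≤ m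

Fits-next : ∀ δ {m m′} → Fits δ m → m < m′ → Fits (next δ) m′
Fits-next δ₀ refl 0<m′ = 0<m′
Fits-next δ₁ 1≤m m<m′ = ≤-trans (s≤s 1≤m) m<m′
Fits-next δ₂ 2≤m m<m′ = ≤-trans (s≤s 2≤m) m<m′
Fits-next δ₃ _ m<m′ = ≤-trans (s≤s z≤n) m<m′

data Tree (A : Set) : Set where
  leaf : A → Tree A
  node : Tree A → Tree A → Tree A

module _ {A : Set} where

  head : Tree A → A
  tail : Tree A → List A
  labels : Tree A → List A
  head (leaf a) = a
  head (node u _) = head u
  tail (leaf _) = []
  tail (node u q) = tail u ++ labels q
  labels t = head t ∷ tail t

  eval : (A → A → A) → Tree A → A
  eval _∙_ (leaf a) = a
  eval _∙_ (node u q) = eval _∙_ u ∙ eval _∙_ q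

  leftSpine rightSpine : Tree A → ℕ
  leftSpine (leaf _) = 0
  leftSpine (node u _) = suc (leftSpine u)
  rightSpine (leaf _) = 0
  rightSpine (node _ q) = suc (rightSpine q)

  fits-leftSpine : ∀ t → Fits (classOf (leftSpine t)) (length (tail t))
  fits-leftSpine (leaf _) = refl
  fits-leftSpine (node u q) = Fits-next _ (fits-leftSpine u)
    (subst (length (tail u) <_) (sym (length-++ (tail u))) (m<m+n _ (s≤s z≤n)))

  fits-rightSpine : ∀ t → Fits (classOf (rightSpine t)) (length (tail t))
  fits-rightSpine (leaf _) = refl
  fits-rightSpine (node u q) = Fits-next _ (fits-rightSpine q)
    (subst (length (tail q) <_) (sym (length-++ (tail u)))
      (≤-trans (n<1+n _) (m≤n+m _ (length (tail u)))))

tabulate-↑ : ∀ {A : Set} m {k} (ρ : Fin (m + k) → A) →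
  tabulate (ρ ∘ (_↑ˡ k)) ++ tabulate (ρ ∘ (m ↑ʳ_)) ≡ tabulate ρ
tabulate-↑ zero ρ = refl
tabulate-↑ (suc m) ρ = cong (ρ zero ∷_) (tabulate-↑ m (ρ ∘ suc))

toTree : ∀ {A : Set} {n} → Bracketing n → (Fin n → A) → Tree A
toTree leaf ρ = leaf (ρ zero)
toTree (node {m} {k} l r) ρ = node (toTree l (ρ ∘ (_↑ˡ k))) (toTree r (ρ ∘ (m ↑ʳ_)))

leftDepth rightDepth : ∀ {n} → Bracketing n → ℕ
leftDepth leaf = 0
leftDepth (node l _) = suc (leftDepth l)
rightDepth leaf = 0
rightDepth (node _ r) = suc (rightDepth r)

classˡ classʳ : ∀ {n} → Bracketing n → DepthClass
classˡ b = classOf (leftDepth b)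
classʳ b = classOf (rightDepth b)

module _ {A : Set} where

  ⟦⟧-toTree : ∀ (_∙_ : A → A → A) {n} (b : Bracketing n) ρ → ⟦ b ⟧ _∙_ ρ ≡ eval _∙_ (toTree b ρ)
  ⟦⟧-toTree _∙_ leaf ρ = refl
  ⟦⟧-toTree _∙_ (node l r) ρ = cong₂ _∙_ (⟦⟧-toTree _∙_ l _) (⟦⟧-toTree _∙_ r _)

  labels-toTree : ∀ {n} (b : Bracketing n) (ρ : Fin n → A) → labels (toTree b ρ) ≡ tabulate ρ
  labels-toTree leaf ρ = refl
  labels-toTree (node {m} l r) ρ = trans (cong₂ _++_ (labels-toTree l _) (labels-toTree r _)) (tabulate-↑ m ρ)

  head-toTree : ∀ {n} (b : Bracketing (suc n)) (ρ : Fin (suc n) → A) → head (toTree b ρ) ≡ ρ zero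
  head-toTree b ρ = proj₁ (∷-injective (labels-toTree b ρ))

  tail-toTree : ∀ {n} (b : Bracketing (suc n)) (ρ : Fin (suc n) → A) → tail (toTree b ρ) ≡ tabulate (ρ ∘ suc)
  tail-toTree b ρ = proj₂ (∷-injective (labels-toTree b ρ))

  length-tail-toTree : ∀ {n} (b : Bracketing (suc n)) (ρ : Fin (suc n) → A) → length (tail (toTree b ρ)) ≡ n
  length-tail-toTree b ρ = trans (cong length (tail-toTree b ρ)) (length-tabulate _)

  leftSpine-toTree : ∀ {n} (b : Bracketing n) (ρ : Fin n → A) → leftSpine (toTree b ρ) ≡ leftDepth b
  leftSpine-toTree leaf ρ = refl
  leftSpine-toTree (node l r) ρ = cong suc (leftSpine-toTree l _)

  rightSpine-toTree : ∀ {n} (b : Bracketing n) (ρ : Fin n → A) → rightSpine (toTree b ρ) ≡ rightDepth b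
  rightSpine-toTree leaf ρ = refl
  rightSpine-toTree (node l r) ρ = cong suc (rightSpine-toTree r _)

fits-classˡ : ∀ {n} (b : Bracketing (suc n)) → Fits (classˡ b) n
fits-classˡ b = subst₂ Fits (cong classOf (leftSpine-toTree b _)) (length-tail-toTree b _)
  (fits-leftSpine (toTree b (λ _ → tt)))

fits-classʳ : ∀ {n} (b : Bracketing (suc n)) → Fits (classʳ b) n
fits-classʳ b = subst₂ Fits (cong classOf (rightSpine-toTree b _)) (length-tail-toTree b _)
  (fits-rightSpine (toTree b (λ _ → tt)))

-- Normal forms

tabulate-extract : ∀ {A : Set} {n} (f : Fin (suc n) → A) i →
  tabulate f ↭ f i ∷ tabulate (f ∘ punchIn i)
tabulate-extract f zero = ↭-refl
tabulate-extract {n = suc n} f (suc i) = ↭-trans (prep (f zero) (tabulate-extract (f ∘ suc) i)) (swap _ _ ↭-refl)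

tabulate-permute : ∀ {A : Set} {n} (f : Fin n → A) (π : Permutation′ n) →
  tabulate (f ∘ (π ⟨$⟩ʳ_)) ↭ tabulate f
tabulate-permute {n = zero} f π = ↭-refl
tabulate-permute {n = suc n} f π = ↭-trans
  (prep _ (↭-trans (↭-reflexive (tabulate-cong (cong f ∘ punchIn-permute π zero)))
                   (tabulate-permute (f ∘ punchIn (π ⟨$⟩ʳ zero)) (remove zero π))))
  (↭-sym (tabulate-extract f (π ⟨$⟩ʳ zero)))

tabulate-tail-↭ : ∀ {A : Set} {n} (f : Fin (suc n) → A) (σ τ : Permutation′ (suc n)) →
  σ ⟨$⟩ʳ zero ≡ τ ⟨$⟩ʳ zero →
  tabulate (f ∘ (σ ⟨$⟩ʳ_) ∘ suc) ↭ tabulate (f ∘ (τ ⟨$⟩ʳ_) ∘ suc)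
tabulate-tail-↭ f σ τ σ₀≡τ₀ = drop-∷ (↭-trans (tabulate-permute f σ)
  (subst (λ i → tabulate f ↭ f i ∷ tabulate (f ∘ (τ ⟨$⟩ʳ_) ∘ suc)) (sym σ₀≡τ₀)
    (↭-sym (tabulate-permute f τ))))

transpose-applyˡ : ∀ {n} (i j : Fin n) → transpose i j ⟨$⟩ʳ i ≡ j
transpose-applyˡ i j rewrite dec-true (i ≟ᶠ i) refl = refl

module NormalForm {G : Set} (_∙_ : G → G → G) (ids : Identities G _∙_) where
  open ≡-Reasoning

  private
    lawI : ∀ x y z → x ∙ (y ∙ z) ≡ x ∙ (z ∙ y)
    lawI = proj₁ ids
    lawII : ∀ w x y z → w ∙ (x ∙ (y ∙ z)) ≡ w ∙ ((x ∙ y) ∙ z)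
    lawII = proj₁ (proj₂ ids)
    lawIII : ∀ x y z → (x ∙ y) ∙ z ≡ (x ∙ z) ∙ y
    lawIII = proj₁ (proj₂ (proj₂ ids))
    lawIV : ∀ w x y z → (w ∙ x) ∙ (y ∙ z) ≡ (w ∙ y) ∙ (x ∙ z)
    lawIV = proj₁ (proj₂ (proj₂ (proj₂ ids)))
    lawV : ∀ v w x y z → (((v ∙ w) ∙ x) ∙ y) ∙ z ≡ v ∙ (w ∙ (x ∙ (y ∙ z)))
    lawV = proj₂ (proj₂ (proj₂ (proj₂ ids)))

  rightComb : G → List G → G
  rightComb h [] = h
  rightComb h (a ∷ as) = h ∙ rightComb a as

  -- normalForm δₖ h [a₁, …, aₘ] = (⋯(h a₁)⋯ aₖ₋₁)(aₖ(aₖ₊₁(⋯ aₘ))).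
  normalForm : DepthClass → G → List G → G
  normalForm δ₀ h _ = h
  normalForm δ₁ h as = rightComb h as
  normalForm δ₂ h [] = h
  normalForm δ₂ h (a ∷ as) = rightComb (h ∙ a) as
  normalForm δ₃ h [] = h
  normalForm δ₃ h (a ∷ as) = normalForm δ₂ (h ∙ a) as

  exchange : ∀ c x y z → c ∙ (x ∙ (y ∙ z)) ≡ c ∙ (y ∙ (x ∙ z))
  exchange c x y z = begin
    c ∙ (x ∙ (y ∙ z)) ≡⟨ lawII c x y z ⟩
    c ∙ ((x ∙ y) ∙ z) ≡⟨ lawI c (x ∙ y) z ⟩
    c ∙ (z ∙ (x ∙ y)) ≡⟨ cong (c ∙_) (lawI z x y) ⟩
    c ∙ (z ∙ (y ∙ x)) ≡⟨ lawI c z (y ∙ x) ⟩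
    c ∙ ((y ∙ x) ∙ z) ≡⟨ lawII c y x z ⟨
    c ∙ (y ∙ (x ∙ z)) ∎

  rightComb-swap : ∀ h x y as → h ∙ (x ∙ rightComb y as) ≡ h ∙ (y ∙ rightComb x as)
  rightComb-swap h x y [] = lawI h x y
  rightComb-swap h x y (a ∷ as) = exchange h x y (rightComb a as)

  rightComb-↭ : ∀ {xs ys} → xs ↭ ys → ∀ h → rightComb h xs ≡ rightComb h ys
  rightComb-↭ ↭.refl h = refl
  rightComb-↭ (prep x p) h = cong (h ∙_) (rightComb-↭ p x)
  rightComb-↭ (↭.trans p q) h = trans (rightComb-↭ p h) (rightComb-↭ q h)
  rightComb-↭ (swap {ys = ys} x y p) h =
    trans (cong (λ z → h ∙ (x ∙ z)) (rightComb-↭ p y)) (rightComb-swap h x y ys)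

  normalForm-↭ : ∀ δ h {xs ys} → xs ↭ ys → normalForm δ h xs ≡ normalForm δ h ys
  normalForm-↭ δ₀ h p = refl
  normalForm-↭ δ₁ h p = rightComb-↭ p h
  normalForm-↭ δ₂ h ↭.refl = refl
  normalForm-↭ δ₂ h (prep x p) = rightComb-↭ p (h ∙ x)
  normalForm-↭ δ₂ h (↭.trans p q) = trans (normalForm-↭ δ₂ h p) (normalForm-↭ δ₂ h q)
  normalForm-↭ δ₂ h (swap {ys = ys} x y p) = trans (cong ((h ∙ x) ∙_) (rightComb-↭ p y)) (swap₂ ys)
    where
    swap₂ : ∀ as → (h ∙ x) ∙ rightComb y as ≡ (h ∙ y) ∙ rightComb x as
    swap₂ [] = lawIII h x y
    swap₂ (a ∷ as) = lawIV h x y (rightComb a as)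
  normalForm-↭ δ₃ h ↭.refl = refl
  normalForm-↭ δ₃ h (prep x p) = normalForm-↭ δ₂ (h ∙ x) p
  normalForm-↭ δ₃ h (↭.trans p q) = trans (normalForm-↭ δ₃ h p) (normalForm-↭ δ₃ h q)
  normalForm-↭ δ₃ h (swap {ys = ys} x y p) =
    trans (rightComb-↭ p ((h ∙ x) ∙ y)) (cong (λ w → rightComb w ys) (lawIII h x y))

  private
    ev : Tree G → G
    ev = eval _∙_

  ∙-rightComb-absorb : ∀ t c x xs → c ∙ (ev t ∙ rightComb x xs) ≡ c ∙ rightComb (head t) (tail t ++ x ∷ xs)
  ∙-rightComb-absorb (leaf a) c x xs = refl
  ∙-rightComb-absorb (node u q) c x xs = begin
    c ∙ ((ev u ∙ ev q) ∙ rightComb x xs)          ≡⟨ lawII c (ev u) (ev q) _ ⟨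
    c ∙ (ev u ∙ (ev q ∙ rightComb x xs))          ≡⟨ cong (c ∙_) (∙-rightComb-absorb q (ev u) x xs) ⟩
    c ∙ (ev u ∙ rightComb (head q) (tail q ++ x ∷ xs)) ≡⟨ ∙-rightComb-absorb u c (head q) (tail q ++ x ∷ xs) ⟩
    c ∙ rightComb (head u) (tail u ++ labels q ++ x ∷ xs)
      ≡⟨ cong (λ as → c ∙ rightComb (head u) as) (++-assoc (tail u) (labels q) (x ∷ xs)) ⟨
    c ∙ rightComb (head u) ((tail u ++ labels q) ++ x ∷ xs) ∎

  ∙-eval : ∀ q c → c ∙ ev q ≡ c ∙ rightComb (head q) (tail q)
  ∙-eval (leaf a) c = refl
  ∙-eval (node u q) c = trans (cong (c ∙_) (∙-eval q (ev u))) (∙-rightComb-absorb u c (head q) (tail q))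

  rightComb-∙-eval : ∀ w a as q → rightComb w (a ∷ as) ∙ ev q ≡ rightComb (w ∙ a) (as ++ labels q)
  rightComb-∙-eval w a [] q = ∙-eval q (w ∙ a)
  rightComb-∙-eval w a (b ∷ as) q = begin
    (w ∙ (a ∙ rightComb b as)) ∙ ev q ≡⟨ lawIII w _ (ev q) ⟩
    (w ∙ ev q) ∙ (a ∙ rightComb b as) ≡⟨ lawIV w (ev q) a _ ⟩
    (w ∙ a) ∙ (ev q ∙ rightComb b as) ≡⟨ ∙-rightComb-absorb q (w ∙ a) b as ⟩
    rightComb (w ∙ a) (labels q ++ b ∷ as) ≡⟨ rightComb-↭ (++-comm (labels q) (b ∷ as)) (w ∙ a) ⟩
    rightComb (w ∙ a) (b ∷ as ++ labels q) ∎

  normalForm-∙-eval : ∀ δ h as q → Fits δ (length as) →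
    normalForm δ h as ∙ ev q ≡ normalForm (next δ) h (as ++ labels q)
  normalForm-∙-eval δ₀ h [] q _ = ∙-eval q h
  normalForm-∙-eval δ₁ h (a ∷ as) q _ = rightComb-∙-eval h a as q
  normalForm-∙-eval δ₂ h (a ∷ b ∷ as) q _ = rightComb-∙-eval (h ∙ a) b as q
  normalForm-∙-eval δ₃ h (a ∷ b ∷ c ∷ as) q _ =
    trans (rightComb-∙-eval ((h ∙ a) ∙ b) c as q) (shorten (as ++ labels q) (++-nonempty as))
    where
    ++-nonempty : ∀ as → ∃ λ z → ∃ λ zs → as ++ labels q ≡ z ∷ zs
    ++-nonempty [] = head q , tail q , refl
    ++-nonempty (z ∷ zs) = z , zs ++ labels q , refl
    shorten : ∀ ws → (∃ λ z → ∃ λ zs → ws ≡ z ∷ zs) →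
      rightComb (((h ∙ a) ∙ b) ∙ c) ws ≡ rightComb h (a ∷ b ∷ c ∷ ws)
    shorten _ (z , zs , refl) = lawV h a b c (rightComb z zs)
  normalForm-∙-eval δ₀ h (_ ∷ _) q ()
  normalForm-∙-eval δ₁ h [] q ()
  normalForm-∙-eval δ₂ h [] q ()
  normalForm-∙-eval δ₂ h (_ ∷ []) q (s≤s ())
  normalForm-∙-eval δ₃ h [] q ()
  normalForm-∙-eval δ₃ h (_ ∷ []) q (s≤s ())
  normalForm-∙-eval δ₃ h (_ ∷ _ ∷ []) q (s≤s (s≤s ()))

  eval-normalForm : ∀ t → ev t ≡ normalForm (classOf (leftSpine t)) (head t) (tail t)
  eval-normalForm (leaf a) = refl
  eval-normalForm (node u q) = trans (cong (_∙ ev q) (eval-normalForm u))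
    (normalForm-∙-eval (classOf (leftSpine u)) (head u) (tail u) q (fits-leftSpine u))

  ⟦⟧-normalForm : ∀ {n} (b : Bracketing (suc n)) ρ →
    ⟦ b ⟧ _∙_ ρ ≡ normalForm (classˡ b) (ρ zero) (tabulate (ρ ∘ suc))
  ⟦⟧-normalForm b ρ = begin
    ⟦ b ⟧ _∙_ ρ      ≡⟨ ⟦⟧-toTree _∙_ b ρ ⟩
    ev (toTree b ρ) ≡⟨ eval-normalForm (toTree b ρ) ⟩
    normalForm (classOf (leftSpine (toTree b ρ))) (head (toTree b ρ)) (tail (toTree b ρ))
      ≡⟨ cong (λ δ → normalForm δ (head (toTree b ρ)) (tail (toTree b ρ))) (cong classOf (leftSpine-toTree b ρ)) ⟩
    normalForm (classˡ b) (head (toTree b ρ)) (tail (toTree b ρ))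
      ≡⟨ cong₂ (normalForm (classˡ b)) (head-toTree b ρ) (tail-toTree b ρ) ⟩
    normalForm (classˡ b) (ρ zero) (tabulate (ρ ∘ suc)) ∎

  ⟦⟧-classˡ : ∀ {n} (b b′ : Bracketing (suc n)) → classˡ b ≡ classˡ b′ → ⟦ b ⟧ _∙_ ≐ ⟦ b′ ⟧ _∙_
  ⟦⟧-classˡ b b′ e ρ = trans (⟦⟧-normalForm b ρ)
    (trans (cong (λ δ → normalForm δ (ρ zero) (tabulate (ρ ∘ suc))) e) (sym (⟦⟧-normalForm b′ ρ)))

  ⟦⟧ᶠ-first : ∀ {n} (b : Bracketing (suc n)) σ τ → σ ⟨$⟩ʳ zero ≡ τ ⟨$⟩ʳ zero →
    ⟦ b , σ ⟧ᶠ _∙_ ≐ ⟦ b , τ ⟧ᶠ _∙_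
  ⟦⟧ᶠ-first b σ τ e x = begin
    ⟦ b ⟧ _∙_ (x ∘ (σ ⟨$⟩ʳ_)) ≡⟨ ⟦⟧-normalForm b _ ⟩
    normalForm (classˡ b) (x (σ ⟨$⟩ʳ zero)) (tabulate (x ∘ (σ ⟨$⟩ʳ_) ∘ suc))
      ≡⟨ cong (λ h → normalForm (classˡ b) (x h) (tabulate (x ∘ (σ ⟨$⟩ʳ_) ∘ suc))) e ⟩
    normalForm (classˡ b) (x (τ ⟨$⟩ʳ zero)) (tabulate (x ∘ (σ ⟨$⟩ʳ_) ∘ suc))
      ≡⟨ normalForm-↭ (classˡ b) _ (tabulate-tail-↭ x σ τ e) ⟩
    normalForm (classˡ b) (x (τ ⟨$⟩ʳ zero)) (tabulate (x ∘ (τ ⟨$⟩ʳ_) ∘ suc)) ≡⟨ ⟦⟧-normalForm b _ ⟨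
    ⟦ b ⟧ _∙_ (x ∘ (τ ⟨$⟩ʳ_)) ∎

rightNested : ∀ n → Bracketing (suc n)
rightNested zero = leaf
rightNested (suc n) = node leaf (rightNested n)

representative : ∀ n → Fin (bound (suc n)) → Bracketing (suc n)
representative 0 _ = leaf
representative 1 _ = node leaf leaf
representative 2 zero = node leaf (node leaf leaf)
representative 2 (suc zero) = node (node leaf leaf) leaf
representative (suc (suc (suc n))) zero = node leaf (rightNested (suc (suc n)))
representative (suc (suc (suc n))) (suc zero) = node (node leaf leaf) (rightNested (suc n))
representative (suc (suc (suc n))) (suc (suc zero)) = node (node (node leaf leaf) leaf) (rightNested n)

pick : ∀ n → DepthClass → Fin (bound (suc n))
pick 0 _ = zero
pick 1 _ = zero
pick 2 δ₂ = suc zero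
pick 2 _ = zero
pick (suc (suc (suc n))) δ₂ = suc zero
pick (suc (suc (suc n))) δ₃ = suc (suc zero)
pick (suc (suc (suc n))) _ = zero

classˡ-pick : ∀ n δ → Fits δ n → classˡ (representative n (pick n δ)) ≡ δ
classˡ-pick 0 δ₀ _ = refl
classˡ-pick 1 δ₁ _ = refl
classˡ-pick 2 δ₁ _ = refl
classˡ-pick 2 δ₂ _ = refl
classˡ-pick (suc (suc (suc n))) δ₁ _ = refl
classˡ-pick (suc (suc (suc n))) δ₂ _ = refl
classˡ-pick (suc (suc (suc n))) δ₃ _ = refl
classˡ-pick 0 δ₁ ()
classˡ-pick 0 δ₂ ()
classˡ-pick 0 δ₃ ()
classˡ-pick (suc n) δ₀ ()
classˡ-pick 1 δ₂ (s≤s ())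
classˡ-pick 1 δ₃ (s≤s ())
classˡ-pick 2 δ₃ (s≤s (s≤s ()))

mirror : ∀ {n} → Bracketing n → Bracketing n
mirror leaf = leaf
mirror (node {m} {k} l r) = subst Bracketing (+-comm k m) (node (mirror r) (mirror l))

rightDepth-subst : ∀ {m n} (e : m ≡ n) (b : Bracketing m) → rightDepth (subst Bracketing e b) ≡ rightDepth b
rightDepth-subst refl b = refl

rightDepth-mirror : ∀ {n} (b : Bracketing n) → rightDepth (mirror b) ≡ leftDepth b
rightDepth-mirror leaf = refl
rightDepth-mirror (node {m} {k} l r) =
  trans (rightDepth-subst (+-comm k m) (node (mirror r) (mirror l))) (cong suc (rightDepth-mirror l))

-- If j ≢ j′, then k ↦ (the index of an S-element covering R k, with j′ redirected
-- to j) would inject Fin N into Fin N ∖ {j′}.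
cover-injective : ∀ {A T : Set} {n N} {F : T → (Fin n → A) → A} → ImageCard≡ T F N →
  (S : Fin N → T) → (∀ t → ∃ λ i → F t ≐ F (S i)) → ∀ {j j′} → F (S j) ≐ F (S j′) → j ≡ j′
cover-injective {N = suc N} {F} (R , _ , R-distinct) S S-covers {j} {j′} Sj≐Sj′ with j ≟ᶠ j′
... | yes j≡j′ = j≡j′
... | no j≢j′ = ⊥-elim (<⇒notInjective (n<1+n N) squeeze-injective)
  where
  redirect : Fin (suc N) → Fin (suc N)
  redirect i with i ≟ᶠ j′
  ... | yes _ = j
  ... | no _ = i

  redirect-≢ : ∀ i → j′ ≢ redirect i
  redirect-≢ i with i ≟ᶠ j′
  ... | yes _ = j≢j′ ∘ sym
  ... | no i≢j′ = i≢j′ ∘ sym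

  redirect-≐ : ∀ i → F (S i) ≐ F (S (redirect i))
  redirect-≐ i with i ≟ᶠ j′
  ... | yes refl = λ x → sym (Sj≐Sj′ x)
  ... | no _ = λ _ → refl

  index : Fin (suc N) → Fin (suc N)
  index k = proj₁ (S-covers (R k))

  R≐S-redirect-index : ∀ k → F (R k) ≐ F (S (redirect (index k)))
  R≐S-redirect-index k x = trans (proj₂ (S-covers (R k)) x) (redirect-≐ (index k) x)

  squeeze : Fin (suc N) → Fin N
  squeeze k = punchOut (redirect-≢ (index k))

  squeeze-injective : Injective _≡_ _≡_ squeeze
  squeeze-injective {k} {k′} e with k ≟ᶠ k′
  ... | yes k≡k′ = k≡k′
  ... | no k≢k′ = ⊥-elim (R-distinct k k′ k≢k′ λ x →
    trans (R≐S-redirect-index k x)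
      (trans (cong (λ i → F (S i) x) (punchOut-injective (redirect-≢ (index k)) (redirect-≢ (index k′)) e))
        (sym (R≐S-redirect-index k′ x))))

module Counting {G : Set} (_∙_ : G → G → G) where

  sₙ≤-byClass : ∀ {n} (cls : Bracketing (suc n) → DepthClass) (rep : Fin (bound (suc n)) → Bracketing (suc n)) →
    (∀ b → Fits (cls b) n) → (∀ c → cls (rep c) ≡ classˡ (representative n c)) →
    (∀ b b′ → cls b ≡ cls b′ → ⟦ b ⟧ _∙_ ≐ ⟦ b′ ⟧ _∙_) →
    sₙ≤ G _∙_ (suc n) (bound (suc n))
  sₙ≤-byClass {n} cls rep fits cls-rep ⟦⟧-cls = rep , λ b →
    pick n (cls b) , ⟦⟧-cls b _ (sym (trans (cls-rep _) (classˡ-pick n (cls b) (fits b))))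

  -- Index combine i c stands for the c-th bracketing with its leaf v occupied by xᵢ.
  fullLinearRep : ∀ {n b} → (Fin b → Bracketing (suc n)) → Fin (suc n) → Fin (suc n * b) → FullLinear (suc n)
  fullLinearRep {n} {b} rep v p = rep (proj₂ (remQuot {suc n} b p)) , transpose v (proj₁ (remQuot {suc n} b p))

  fullLinearRep-combine : ∀ {n b} (rep : Fin b → Bracketing (suc n)) v i c →
    fullLinearRep rep v (combine i c) ≡ (rep c , transpose v i)
  fullLinearRep-combine {n} {b} rep v i c =
    cong (λ (i , c) → rep c , transpose v i) (remQuot-combine {suc n} {b} i c)

  sacₙ≤-from-sₙ≤ : ∀ {n b} (v : Fin (suc n)) →
    (∀ t σ τ → σ ⟨$⟩ʳ v ≡ τ ⟨$⟩ʳ v → ⟦ t , σ ⟧ᶠ _∙_ ≐ ⟦ t , τ ⟧ᶠ _∙_) →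
    sₙ≤ G _∙_ (suc n) b → sacₙ≤ G _∙_ (suc n) (suc n * b)
  sacₙ≤-from-sₙ≤ v fixing-v (rep , covers) = fullLinearRep rep v , λ (t , σ) →
    let i = σ ⟨$⟩ʳ v ; (c , t≐rep) = covers t in
    combine i c , λ x → begin
      ⟦ t ⟧ _∙_ (x ∘ (σ ⟨$⟩ʳ_))                   ≡⟨ fixing-v t σ (transpose v i) (sym (transpose-applyˡ v i)) x ⟩
      ⟦ t ⟧ _∙_ (x ∘ (transpose v i ⟨$⟩ʳ_))        ≡⟨ t≐rep _ ⟩
      ⟦ rep c , transpose v i ⟧ᶠ _∙_ x            ≡⟨ cong (λ s → ⟦ s ⟧ᶠ _∙_ x) (fullLinearRep-combine rep v i c) ⟨
      ⟦ fullLinearRep rep v (combine i c) ⟧ᶠ _∙_ x ∎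
    where open ≡-Reasoning

  sacₙ≡⇒injective : ∀ {n b} (v : Fin (suc n)) (rep : Fin b → Bracketing (suc n)) →
    (∀ t → ∃ λ p → ⟦ t ⟧ᶠ _∙_ ≐ ⟦ fullLinearRep rep v p ⟧ᶠ _∙_) →
    sacₙ≡ G _∙_ (suc n) (suc n * b) → ∀ {c c′} → ⟦ rep c ⟧ _∙_ ≐ ⟦ rep c′ ⟧ _∙_ → c ≡ c′
  sacₙ≡⇒injective v rep covers sac {c} {c′} rep≐ = proj₂ (combine-injective v c v c′
    (cover-injective sac (fullLinearRep rep v) covers λ x → begin
      ⟦ fullLinearRep rep v (combine v c) ⟧ᶠ _∙_ x  ≡⟨ cong (λ s → ⟦ s ⟧ᶠ _∙_ x) (fullLinearRep-combine rep v v c) ⟩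
      ⟦ rep c , transpose v v ⟧ᶠ _∙_ x             ≡⟨ rep≐ _ ⟩
      ⟦ rep c′ , transpose v v ⟧ᶠ _∙_ x            ≡⟨ cong (λ s → ⟦ s ⟧ᶠ _∙_ x) (fullLinearRep-combine rep v v c′) ⟨
      ⟦ fullLinearRep rep v (combine v c′) ⟧ᶠ _∙_ x ∎))
    where open ≡-Reasoning

module Spectra {G : Set} (_∙_ : G → G → G) (ids : Identities G _∙_) where
  open NormalForm _∙_ ids
  open Counting _∙_

  sₙ≤-identities : ∀ n → sₙ≤ G _∙_ (suc n) (bound (suc n))
  sₙ≤-identities n = sₙ≤-byClass classˡ (representative n) fits-classˡ (λ _ → refl) ⟦⟧-classˡ

  sacₙ≤-identities : ∀ n → sacₙ≤ G _∙_ (suc n) (suc n * bound (suc n))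
  sacₙ≤-identities n = sacₙ≤-from-sₙ≤ zero ⟦⟧ᶠ-first (sₙ≤-identities n)

  sacₙ≡⇒sₙ≡ : ∀ n → sacₙ≡ G _∙_ (suc n) (suc n * bound (suc n)) → sₙ≡ G _∙_ (suc n) (bound (suc n))
  sacₙ≡⇒sₙ≡ n sac = representative n , proj₂ (sₙ≤-identities n) , λ c c′ c≢c′ →
    c≢c′ ∘ sacₙ≡⇒injective zero (representative n) (proj₂ (sacₙ≤-identities n)) sac

-- The groupoids SC3242 and SC3302

cycle : Fin 3 → Fin 3
cycle zero = suc zero
cycle (suc zero) = suc (suc zero)
cycle (suc (suc zero)) = zero

cycle-injective : Injective _≡_ _≡_ cycle
cycle-injective {zero} {zero} _ = refl
cycle-injective {suc zero} {suc zero} _ = refl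
cycle-injective {suc (suc zero)} {suc (suc zero)} _ = refl
cycle-injective {zero} {suc zero} ()
cycle-injective {zero} {suc (suc zero)} ()
cycle-injective {suc zero} {zero} ()
cycle-injective {suc zero} {suc (suc zero)} ()
cycle-injective {suc (suc zero)} {zero} ()
cycle-injective {suc (suc zero)} {suc zero} ()

-- cycleBy (classOf d) is the d-th power of cycle, which has order 3.
cycleBy : DepthClass → Fin 3 → Fin 3
cycleBy δ₀ x = x
cycleBy δ₁ x = cycle x
cycleBy δ₂ x = cycle (cycle x)
cycleBy δ₃ x = x

cycleBy-next : ∀ δ x → cycleBy (next δ) x ≡ cycle (cycleBy δ x)
cycleBy-next δ₀ x = refl
cycleBy-next δ₁ x = refl
cycleBy-next δ₂ zero = refl
cycleBy-next δ₂ (suc zero) = refl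
cycleBy-next δ₂ (suc (suc zero)) = refl
cycleBy-next δ₃ x = refl

cycleBy-injective : ∀ δ → Injective _≡_ _≡_ (cycleBy δ)
cycleBy-injective δ₀ e = e
cycleBy-injective δ₁ e = cycle-injective e
cycleBy-injective δ₂ e = cycle-injective (cycle-injective e)
cycleBy-injective δ₃ e = e

cycleBy-representative-injective : ∀ n → Injective _≡_ _≡_ (λ c → cycleBy (classˡ (representative n c)) zero)
cycleBy-representative-injective 0 {zero} {zero} _ = refl
cycleBy-representative-injective 1 {zero} {zero} _ = refl
cycleBy-representative-injective 2 {zero} {zero} _ = refl
cycleBy-representative-injective 2 {suc zero} {suc zero} _ = refl
cycleBy-representative-injective 2 {zero} {suc zero} ()
cycleBy-representative-injective 2 {suc zero} {zero} ()
cycleBy-representative-injective (suc (suc (suc n))) {zero} {zero} _ = refl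
cycleBy-representative-injective (suc (suc (suc n))) {suc zero} {suc zero} _ = refl
cycleBy-representative-injective (suc (suc (suc n))) {suc (suc zero)} {suc (suc zero)} _ = refl
cycleBy-representative-injective (suc (suc (suc n))) {zero} {suc zero} ()
cycleBy-representative-injective (suc (suc (suc n))) {zero} {suc (suc zero)} ()
cycleBy-representative-injective (suc (suc (suc n))) {suc zero} {zero} ()
cycleBy-representative-injective (suc (suc (suc n))) {suc zero} {suc (suc zero)} ()
cycleBy-representative-injective (suc (suc (suc n))) {suc (suc zero)} {zero} ()
cycleBy-representative-injective (suc (suc (suc n))) {suc (suc zero)} {suc zero} ()

indicator : ∀ {n} → Fin n → Fin n → Fin 3
indicator i j with i ≟ᶠ j
... | yes _ = suc zero
... | no _ = zero

indicator-diagonal : ∀ {n} (i j : Fin n) → indicator i i ≡ indicator i j → i ≡ j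
indicator-diagonal i j e with i ≟ᶠ i | i ≟ᶠ j
... | _ | yes i≡j = i≡j
... | yes _ | no _ = contradiction e λ ()
... | no i≢i | no _ = contradiction refl i≢i

leftmost rightmost : ∀ {n} → Bracketing n → Fin n
leftmost leaf = zero
leftmost (node {k = k} l _) = leftmost l ↑ˡ k
rightmost leaf = zero
rightmost (node {m} _ r) = m ↑ʳ rightmost r

leftmost-zero : ∀ {n} (b : Bracketing (suc n)) → leftmost b ≡ zero
leftmost-zero b = toℕ-injective (toℕ-leftmost b)
  where
  toℕ-leftmost : ∀ {n} (b : Bracketing n) → toℕ (leftmost b) ≡ 0
  toℕ-leftmost leaf = refl
  toℕ-leftmost (node {k = k} l _) = trans (toℕ-↑ˡ (leftmost l) k) (toℕ-leftmost l)

rightmost-fromℕ : ∀ {n} (b : Bracketing (suc n)) → rightmost b ≡ fromℕ n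
rightmost-fromℕ {n} b = toℕ-injective (trans (suc-injective (suc-toℕ-rightmost b)) (sym (toℕ-fromℕ n)))
  where
  suc-toℕ-rightmost : ∀ {n} (b : Bracketing n) → suc (toℕ (rightmost b)) ≡ n
  suc-toℕ-rightmost leaf = refl
  suc-toℕ-rightmost (node {m} _ r) =
    trans (cong suc (toℕ-↑ʳ m (rightmost r))) (trans (sym (+-suc m _)) (cong (m +_) (suc-toℕ-rightmost r)))

⟦⟧-SC3242 : ∀ {n} (b : Bracketing n) ρ → ⟦ b ⟧ SC3242 ρ ≡ cycleBy (classˡ b) (ρ (leftmost b))
⟦⟧-SC3242 leaf ρ = refl
⟦⟧-SC3242 (node {m} {k} l r) ρ =
  trans (SC3242-cycle (⟦ l ⟧ SC3242 (ρ ∘ (_↑ˡ k))) (⟦ r ⟧ SC3242 (ρ ∘ (m ↑ʳ_))))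
    (trans (cong cycle (⟦⟧-SC3242 l _)) (sym (cycleBy-next (classˡ l) _)))
  where
  SC3242-cycle : ∀ x y → SC3242 x y ≡ cycle x
  SC3242-cycle zero _ = refl
  SC3242-cycle (suc zero) _ = refl
  SC3242-cycle (suc (suc zero)) _ = refl

⟦⟧-SC3302 : ∀ {n} (b : Bracketing n) ρ → ⟦ b ⟧ SC3302 ρ ≡ cycleBy (classʳ b) (ρ (rightmost b))
⟦⟧-SC3302 leaf ρ = refl
⟦⟧-SC3302 (node {m} {k} l r) ρ =
  trans (SC3302-cycle (⟦ l ⟧ SC3302 (ρ ∘ (_↑ˡ k))) (⟦ r ⟧ SC3302 (ρ ∘ (m ↑ʳ_))))
    (trans (cong cycle (⟦⟧-SC3302 r _)) (sym (cycleBy-next (classʳ r) _)))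
  where
  SC3302-cycle : ∀ x y → SC3302 x y ≡ cycle y
  SC3302-cycle _ zero = refl
  SC3302-cycle _ (suc zero) = refl
  SC3302-cycle _ (suc (suc zero)) = refl

module ShiftGroupoid (_∙_ : Fin 3 → Fin 3 → Fin 3) (cls : ∀ {n} → Bracketing n → DepthClass)
  (pivot : ∀ n → Fin (suc n))
  (⟦⟧-cycleBy : ∀ {n} (b : Bracketing (suc n)) ρ → ⟦ b ⟧ _∙_ ρ ≡ cycleBy (cls b) (ρ (pivot n)))
  (fits-cls : ∀ {n} (b : Bracketing (suc n)) → Fits (cls b) n)
  (rep : ∀ n → Fin (bound (suc n)) → Bracketing (suc n))
  (cls-rep : ∀ n c → cls (rep n c) ≡ classˡ (representative n c))
  where
  open Counting _∙_

  sₙ≤-shift : ∀ n → sₙ≤ (Fin 3) _∙_ (suc n) (bound (suc n))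
  sₙ≤-shift n = sₙ≤-byClass cls (rep n) fits-cls (cls-rep n) λ b b′ e ρ →
    trans (⟦⟧-cycleBy b ρ) (trans (cong (λ δ → cycleBy δ (ρ (pivot n))) e) (sym (⟦⟧-cycleBy b′ ρ)))

  ⟦rep⟧ : ∀ n c ρ → ⟦ rep n c ⟧ _∙_ ρ ≡ cycleBy (classˡ (representative n c)) (ρ (pivot n))
  ⟦rep⟧ n c ρ = trans (⟦⟧-cycleBy (rep n c) ρ) (cong (λ δ → cycleBy δ (ρ (pivot n))) (cls-rep n c))

  rep-injective : ∀ n {c c′} → ⟦ rep n c ⟧ _∙_ ≐ ⟦ rep n c′ ⟧ _∙_ → c ≡ c′
  rep-injective n {c} {c′} e = cycleBy-representative-injective n
    (trans (sym (⟦rep⟧ n c _)) (trans (e (λ _ → zero)) (⟦rep⟧ n c′ _)))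

  sₙ≡-shift : ∀ n → sₙ≡ (Fin 3) _∙_ (suc n) (bound (suc n))
  sₙ≡-shift n = rep n , proj₂ (sₙ≤-shift n) , λ c c′ c≢c′ → c≢c′ ∘ rep-injective n

  sacₙ≤-shift : ∀ n → sacₙ≤ (Fin 3) _∙_ (suc n) (suc n * bound (suc n))
  sacₙ≤-shift n = sacₙ≤-from-sₙ≤ (pivot n) fixing-pivot (sₙ≤-shift n)
    where
    fixing-pivot : ∀ t σ τ → σ ⟨$⟩ʳ pivot n ≡ τ ⟨$⟩ʳ pivot n → ⟦ t , σ ⟧ᶠ _∙_ ≐ ⟦ t , τ ⟧ᶠ _∙_
    fixing-pivot t σ τ e x =
      trans (⟦⟧-cycleBy t _) (trans (cong (cycleBy (cls t) ∘ x) e) (sym (⟦⟧-cycleBy t _)))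

  ⟦fullLinearRep⟧ : ∀ n i c x →
    ⟦ fullLinearRep (rep n) (pivot n) (combine i c) ⟧ᶠ _∙_ x ≡ cycleBy (classˡ (representative n c)) (x i)
  ⟦fullLinearRep⟧ n i c x = trans (cong (λ s → ⟦ s ⟧ᶠ _∙_ x) (fullLinearRep-combine (rep n) (pivot n) i c))
    (trans (⟦rep⟧ n c _) (cong (cycleBy (classˡ (representative n c)) ∘ x) (transpose-applyˡ (pivot n) i)))

  fullLinearRep-injective : ∀ n {p p′} →
    ⟦ fullLinearRep (rep n) (pivot n) p ⟧ᶠ _∙_ ≐ ⟦ fullLinearRep (rep n) (pivot n) p′ ⟧ᶠ _∙_ → p ≡ p′
  fullLinearRep-injective n {p} {p′} e
    with combine-surjective {suc n} {bound (suc n)} p | combine-surjective {suc n} {bound (suc n)} p′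
  ... | i , c , refl | i′ , c′ , refl with cycleBy-representative-injective n
        (trans (sym (⟦fullLinearRep⟧ n i c _)) (trans (e (λ _ → zero)) (⟦fullLinearRep⟧ n i′ c′ _)))
  ... | refl = cong (λ i → combine i c) (indicator-diagonal i i′ (cycleBy-injective (classˡ (representative n c))
        (trans (sym (⟦fullLinearRep⟧ n i c (indicator i))) (trans (e (indicator i)) (⟦fullLinearRep⟧ n i′ c (indicator i))))))

  sacₙ≡-shift : ∀ n → sacₙ≡ (Fin 3) _∙_ (suc n) (suc n * bound (suc n))
  sacₙ≡-shift n = proj₁ (sacₙ≤-shift n) , proj₂ (sacₙ≤-shift n) , λ p p′ p≢p′ →
    p≢p′ ∘ fullLinearRep-injective n

module SC3242-spectra = ShiftGroupoid SC3242 classˡ (λ _ → zero)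
  (λ b ρ → trans (⟦⟧-SC3242 b ρ) (cong (cycleBy (classˡ b) ∘ ρ) (leftmost-zero b)))
  fits-classˡ representative (λ _ _ → refl)

module SC3302-spectra = ShiftGroupoid SC3302 classʳ fromℕ
  (λ b ρ → trans (⟦⟧-SC3302 b ρ) (cong (cycleBy (classʳ b) ∘ ρ) (rightmost-fromℕ b)))
  fits-classʳ (λ n → mirror ∘ representative n) (λ n c → cong classOf (rightDepth-mirror (representative n c)))

proposition3p5 : (∀ (G : Set) (_∙_ : G → G → G) → Identities G _∙_ → ∀ (n : ℕ) → 1 ≤ n →
    sₙ≤ G _∙_ n (bound n) ×
    sacₙ≤ G _∙_ n (n * bound n) ×
    (sacₙ≡ G _∙_ n (n * bound n) → sₙ≡ G _∙_ n (bound n)))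
  ×
  (∀ (n : ℕ) → 1 ≤ n →
    sₙ≡ (Fin 3) SC3242 n (bound n) × sacₙ≡ (Fin 3) SC3242 n (n * bound n))
  ×
  (∀ (n : ℕ) → 1 ≤ n →
    sₙ≡ (Fin 3) SC3302 n (bound n) × sacₙ≡ (Fin 3) SC3302 n (n * bound n))
proposition3p5 = identities-bounds , SC3242-equalities , SC3302-equalities
  where
  identities-bounds : ∀ (G : Set) (_∙_ : G → G → G) → Identities G _∙_ → ∀ n → 1 ≤ n →
    sₙ≤ G _∙_ n (bound n) × sacₙ≤ G _∙_ n (n * bound n) ×
    (sacₙ≡ G _∙_ n (n * bound n) → sₙ≡ G _∙_ n (bound n))
  identities-bounds G _∙_ ids (suc n) _ = sₙ≤-identities n , sacₙ≤-identities n , sacₙ≡⇒sₙ≡ n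
    where open Spectra _∙_ ids

  SC3242-equalities : ∀ n → 1 ≤ n → sₙ≡ (Fin 3) SC3242 n (bound n) × sacₙ≡ (Fin 3) SC3242 n (n * bound n)
  SC3242-equalities (suc n) _ = SC3242-spectra.sₙ≡-shift n , SC3242-spectra.sacₙ≡-shift n

  SC3302-equalities : ∀ n → 1 ≤ n → sₙ≡ (Fin 3) SC3302 n (bound n) × sacₙ≡ (Fin 3) SC3302 n (n * bound n)
  SC3302-equalities (suc n) _ = SC3302-spectra.sₙ≡-shift n , SC3302-spectra.sacₙ≡-shift n
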